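{- Let $X$ and $Y$ be states of graphs $G$ and $H$, and let $f:U(X)\to U(Y)$ be a graph isomorphism, with induced bijection $a_f:A(U(X))\to A(U(Y))$, $a_f((v,w))=(f(v),f(w))$. Then $a_f$ is a state isomorphism from $X$ to $Y$ if and only if $a_f$ is a local state isomorphism at every vertex $x$ of $U(X)$.
   Context: Graphs are finite, simple, without isolated vertices. For a graph $G$, $A(G)$ is the set of arrows $(v,w)$ with $\{v,w\}\in E(G)$; flip sends $(v,w)$ to $(w,v)$. A decoration is a set of arrows, at most one per edge; a vertex is a sink (source) if all its edges carry arrows into (out of) it; a state is a decoration with no sink or source at a vertex of degree $\ge2$. A follower of state $X$ is a state $X\cup\{(v,w)\}$ with $\{v,w\}$ unmarked in $X$; descendents are iterated followers. $U(X)$ is the subgraph of $G$ induced by edges carrying no arrow of $X$. For a bijection $a:A(U(X))\to A(U(Y))$, $a^+(X^*)=Y\cup a(X^*\setminus X)$ for decorations $X^*\supseteq X$. A state isomorphism from $X$ to $Y$ is a bijection $a:A(U(X))\to A(U(Y))$ commuting with flip such that $a^+$ restricts to a bijection from the descendents of $X$ onto the descendents of $Y$. For a vertex $v$ of $U(X)$, the flowers of $X$ at $v$ are $X_t(v)=X\cup\{(v,v'):\{v,v'\}\in E(U(X))\}$ and $X_h(v)=X\cup\{(v',v):\{v,v'\}\in E(U(X))\}$. $a_f$ is a local state isomorphism at $x$ if each flower of $X$ at $x$ is a state if and only if its image under $a_f^+$ is a state. -}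

module Defs where

open import Data.Nat using (ℕ; zero; suc; _+_; _≤_)
open import Data.Fin using (Fin; zero; suc; _≟_)
open import Data.Bool using (Bool; true; false; _∧_; _∨_; not; T; if_then_else_)
open import Data.Bool.Properties using (T-irrelevant; ∨-comm)
open import Data.Unit using (tt)
open import Data.Empty using (⊥)
open import Data.Product using (Σ; ∃; _×_; _,_; proj₁; proj₂)
open import Relation.Nullary using (¬_; does)
open import Relation.Binary.PropositionalEquality
  using (_≡_; refl; sym; trans; cong; subst)
open import Function.Bundles using (_↔_; _⇔_; Inverse; Equivalence; mk↔ₛ′)

record Graph (n : ℕ) : Set where
  field
    adj        : Fin n → Fin n → Bool
    irrefl     : ∀ v → adj v v ≡ false
    symmetric  : ∀ v w → adj v w ≡ adj w v
    noIsolated : ∀ v → Σ (Fin n) λ w → T (adj v w)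
open Graph public

countFin : ∀ {n} → (Fin n → Bool) → ℕ
countFin {zero}  p = 0
countFin {suc n} p = (if p zero then 1 else 0) + countFin (λ i → p (suc i))

anyFin : ∀ {n} → (Fin n → Bool) → Bool
anyFin {zero}  p = false
anyFin {suc n} p = p zero ∨ anyFin (λ i → p (suc i))

anyFin-intro : ∀ {n} (p : Fin n → Bool) (w : Fin n) → T (p w) → T (anyFin p)
anyFin-intro {suc n} p zero h with p zero
... | true = tt
anyFin-intro {suc n} p (suc w) h with p zero
... | true  = tt
... | false = anyFin-intro (λ i → p (suc i)) w h

deg : ∀ {n} → Graph n → Fin n → ℕ
deg G v = countFin (adj G v)

-- Decorations: a set of arrows, encoded by its (decidable) membership
-- function; (v , w) ∈ D  iff  D v w ≡ true.

Deco : ℕ → Set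
Deco n = Fin n → Fin n → Bool

_≐_ : ∀ {n} → Deco n → Deco n → Set
D ≐ E = ∀ v w → D v w ≡ E v w

IsDecoration : ∀ {n} → Graph n → Deco n → Set
IsDecoration G D =
  (∀ v w → T (D v w) → T (adj G v w)) ×
  (∀ v w → T (D v w) → T (D w v) → ⊥)

Sink : ∀ {n} → Graph n → Deco n → Fin n → Set
Sink G D v = ∀ w → T (adj G v w) → T (D w v)

Source : ∀ {n} → Graph n → Deco n → Fin n → Set
Source G D v = ∀ w → T (adj G v w) → T (D v w)

IsState : ∀ {n} → Graph n → Deco n → Set
IsState G D = IsDecoration G D ×
  (∀ v → 2 ≤ deg G v → ¬ Sink G D v × ¬ Source G D v)

-- {v,w} is an edge of G carrying no arrow of D, i.e. an edge of U(D)
unmarked : ∀ {n} → Graph n → Deco n → Fin n → Fin n → Bool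
unmarked G D v w = adj G v w ∧ not (D v w ∨ D w v)

unmarked-sym : ∀ {n} (G : Graph n) (D : Deco n) v w →
               unmarked G D v w ≡ unmarked G D w v
unmarked-sym G D v w rewrite symmetric G v w | ∨-comm (D v w) (D w v) = refl

-- vertices of U(D): endpoints of unmarked edges
inU : ∀ {n} → Graph n → Deco n → Fin n → Bool
inU G D v = anyFin (unmarked G D v)

VU : ∀ {n} → Graph n → Deco n → Set
VU {n} G D = Σ (Fin n) λ v → T (inU G D v)

AU : ∀ {n} → Graph n → Deco n → Set
AU {n} G D = Σ (Fin n × Fin n) λ p → T (unmarked G D (proj₁ p) (proj₂ p))

src tgt : ∀ {n} {P : Fin n × Fin n → Set} → Σ (Fin n × Fin n) P → Fin n
src α = proj₁ (proj₁ α)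
tgt α = proj₂ (proj₁ α)

flipA : ∀ {n} (G : Graph n) (D : Deco n) → AU G D → AU G D
flipA G D ((v , w) , p) =
  (w , v) , subst T (unmarked-sym G D v w) p

add : ∀ {n} → Deco n → Fin n → Fin n → Deco n
add D v w a b = D a b ∨ (does (a ≟ v) ∧ does (b ≟ w))

-- Descendents (X itself = zero iterations of "follower")

data Desc {n} (G : Graph n) (X : Deco n) : Deco n → Set where
  d-refl : Desc G X X
  d-step : ∀ {Z} v w → Desc G X Z → T (unmarked G Z v w) →
           IsState G (add Z v w) → Desc G X (add Z v w)

-- a⁺(X*) = Y ∪ a(X* ∖ X), for a bijection a : A(U(X)) ↔ A(U(Y)).
-- An arrow p of H lies in a(X* ∖ X) iff p ∈ A(U(Y)) and a⁻¹(p) ∈ X* ∖ X.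

pick : (b : Bool) → (T b → Bool) → Bool
pick true  k = k tt
pick false k = false

aplus : ∀ {n m} (G : Graph n) (H : Graph m) (X : Deco n) (Y : Deco m) →
        AU G X ↔ AU H Y → Deco n → Deco m
aplus G H X Y a Xs v' w' =
  Y v' w' ∨ pick (unmarked H Y v' w') λ q →
    let α = Inverse.from a ((v' , w') , q)
    in Xs (src α) (tgt α) ∧ not (X (src α) (tgt α))

StateIso : ∀ {n m} (G : Graph n) (H : Graph m) (X : Deco n) (Y : Deco m) →
           AU G X ↔ AU H Y → Set
StateIso G H X Y a =
  (∀ α → Inverse.to a (flipA G X α) ≡ flipA H Y (Inverse.to a α)) ×
  (∀ Xs → Desc G X Xs → Σ _ λ Ys → Desc H Y Ys × aplus G H X Y a Xs ≐ Ys) ×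
  (∀ X₁ X₂ → Desc G X X₁ → Desc G X X₂ →
     aplus G H X Y a X₁ ≐ aplus G H X Y a X₂ → X₁ ≐ X₂) ×
  (∀ Ys → Desc H Y Ys → Σ _ λ Xs → Desc G X Xs × aplus G H X Y a Xs ≐ Ys)

flowerT : ∀ {n} → Graph n → Deco n → Fin n → Deco n
flowerT G X x a b = X a b ∨ (does (a ≟ x) ∧ unmarked G X x b)

flowerH : ∀ {n} → Graph n → Deco n → Fin n → Deco n
flowerH G X x a b = X a b ∨ (does (b ≟ x) ∧ unmarked G X x a)

LocalIso : ∀ {n m} (G : Graph n) (H : Graph m) (X : Deco n) (Y : Deco m) →
           AU G X ↔ AU H Y → VU G X → Set
LocalIso G H X Y a (x , _) =
  (IsState G (flowerT G X x) ⇔ IsState H (aplus G H X Y a (flowerT G X x))) ×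
  (IsState G (flowerH G X x) ⇔ IsState H (aplus G H X Y a (flowerH G X x)))

record GraphIsoU {n m} (G : Graph n) (H : Graph m) (X : Deco n) (Y : Deco m) : Set where
  field
    bij : VU G X ↔ VU H Y
    preserves : ∀ u u' →
      T (unmarked G X (proj₁ u) (proj₁ u')) ⇔
      T (unmarked H Y (proj₁ (Inverse.to bij u)) (proj₁ (Inverse.to bij u')))

module _ {n m} {G : Graph n} {H : Graph m} {X : Deco n} {Y : Deco m}
         (f : GraphIsoU G H X Y) where
  open GraphIsoU f
  private
    fv = Inverse.to bij
    gv = Inverse.from bij
    fg : ∀ y → fv (gv y) ≡ y
    fg = Inverse.strictlyInverseˡ bij
    gf : ∀ x → gv (fv x) ≡ x
    gf = Inverse.strictlyInverseʳ bij

    inU-src : ∀ {k} (K : Graph k) (D : Deco k) v w →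
              T (unmarked K D v w) → T (inU K D v)
    inU-src K D v w p = anyFin-intro (unmarked K D v) w p

    inU-tgt : ∀ {k} (K : Graph k) (D : Deco k) v w →
              T (unmarked K D v w) → T (inU K D w)
    inU-tgt K D v w p =
      inU-src K D w v (subst T (unmarked-sym K D v w) p)

    AU-≡ : ∀ {k} {P : Fin k × Fin k → Bool} (α β : Σ (Fin k × Fin k) λ p → T (P p)) →
           proj₁ α ≡ proj₁ β → α ≡ β
    AU-≡ (p , x) (.p , y) refl = cong (p ,_) (T-irrelevant x y)

    toA : AU G X → AU H Y
    toA ((v , w) , p) =
      let v̂ = fv (v , inU-src G X v w p)
          ŵ = fv (w , inU-tgt G X v w p)
      in (proj₁ v̂ , proj₁ ŵ) ,
         Equivalence.to (preserves (v , inU-src G X v w p) (w , inU-tgt G X v w p)) p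

    fromA : AU H Y → AU G X
    fromA ((v' , w') , q) =
      let v̂' = (v' , inU-src H Y v' w' q)
          ŵ' = (w' , inU-tgt H Y v' w' q)
          q' = subst₂' (sym (fg v̂')) (sym (fg ŵ')) q
      in (proj₁ (gv v̂') , proj₁ (gv ŵ')) ,
         Equivalence.from (preserves (gv v̂') (gv ŵ')) q'
      where
      subst₂' : ∀ {a a' b b' : VU H Y} → a ≡ a' → b ≡ b' →
                T (unmarked H Y (proj₁ a) (proj₁ b)) →
                T (unmarked H Y (proj₁ a') (proj₁ b'))
      subst₂' refl refl t = t

    toFrom : ∀ β → toA (fromA β) ≡ β
    toFrom ((v' , w') , q) =
      AU-≡ _ _ (cong₂' (cong proj₁ (trans (cong fv (VU-≡ _ _ refl)) (fg _)))
                       (cong proj₁ (trans (cong fv (VU-≡ _ _ refl)) (fg _))))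
      where
      cong₂' : ∀ {a a' b b' : Fin m} → a ≡ a' → b ≡ b' → (a , b) ≡ (a' , b')
      cong₂' refl refl = refl
      VU-≡ : (x y : VU G X) → proj₁ x ≡ proj₁ y → x ≡ y
      VU-≡ (p , x) (.p , y) refl = cong (p ,_) (T-irrelevant x y)

    fromTo : ∀ α → fromA (toA α) ≡ α
    fromTo ((v , w) , p) =
      AU-≡ _ _ (cong₂' (cong proj₁ (trans (cong gv (VU-≡ _ _ refl)) (gf _)))
                       (cong proj₁ (trans (cong gv (VU-≡ _ _ refl)) (gf _))))
      where
      cong₂' : ∀ {a a' b b' : Fin n} → a ≡ a' → b ≡ b' → (a , b) ≡ (a' , b')
      cong₂' refl refl = refl
      VU-≡ : (x y : VU H Y) → proj₁ x ≡ proj₁ y → x ≡ y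
      VU-≡ (p , x) (.p , y) refl = cong (p ,_) (T-irrelevant x y)

  inducedArrowBij : AU G X ↔ AU H Y
  inducedArrowBij = mk↔ₛ′ toA fromA toFrom fromTo

-- The descendents of a state X are exactly the states Z ⊇ X, and on the decorations
-- X ∪ S with S ⊆ A(U(X)) the map a⁺ is a bijection onto the analogous decorations for
-- Y. So a is a state isomorphism iff it commutes with flip and such a Z is a state
-- exactly when a⁺ Z is. Flowers are of this form, which gives one direction.
-- Conversely, if such a Z is a sink at x, it contains the head-flower of X at x, which
-- is again a sink at x; since subsets of states are states, reflecting the state
-- property on flowers already reflects it on every such Z (dually for sources). For
-- a = a_f the image of a flower at x is the flower of Y at f(x), so the local
-- hypotheses give this reflection for a_f and for its inverse, and reflection in both
-- directions is preservation.
module Submission where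

open import Defs
open import Data.Nat using (_≤_)
open import Data.Fin using (Fin; _≟_)
open import Data.Bool using (Bool; true; false; _∧_; _∨_; not; T)
open import Data.Bool.Properties using (T?; T-irrelevant; T-∨; T-∧; T-≡; ∨-identityʳ; ∧-identityʳ; ∧-zeroʳ)
open import Data.Unit using (tt)
open import Data.Empty using (⊥; ⊥-elim)
open import Data.Product using (Σ; _×_; _,_; proj₁; proj₂)
open import Data.Sum using (_⊎_; inj₁; inj₂)
open import Data.List using (List; []; _∷_; allFin; cartesianProduct)
open import Data.List.Membership.Propositional using (_∈_)
open import Data.List.Membership.Propositional.Properties using (∈-allFin; ∈-cartesianProduct⁺)
open import Data.List.Relation.Unary.Any using (here; there)
open import Function.Bundles using (_⇔_; _↔_; Inverse; Equivalence; mk⇔)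
open import Function.Construct.Symmetry using (↔-sym)
open import Relation.Nullary using (¬_; does; yes; no)
open import Relation.Nullary.Decidable using (does-⇔)
open import Relation.Binary.PropositionalEquality
  using (_≡_; refl; sym; trans; cong; cong₂; subst; module ≡-Reasoning)

T-not⇔¬T : ∀ {b} → T (not b) ⇔ (¬ T b)
T-not⇔¬T {false} = mk⇔ (λ _ ()) (λ _ → tt)
T-not⇔¬T {true}  = mk⇔ (λ ()) (λ ¬t → ¬t tt)

¬T⇒≡false : ∀ {b} → ¬ T b → b ≡ false
¬T⇒≡false {false} _  = refl
¬T⇒≡false {true}  ¬t = ⊥-elim (¬t tt)

T-injective : ∀ {a b} → (T a → T b) → (T b → T a) → a ≡ b
T-injective {false} {false} _ _ = refl
T-injective {false} {true}  _ g = ⊥-elim (g tt)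
T-injective {true}  {false} f _ = ⊥-elim (f tt)
T-injective {true}  {true}  _ _ = refl

T-does≟⇔ : ∀ {k} {a b : Fin k} → T (does (a ≟ b)) ⇔ a ≡ b
T-does≟⇔ {a = a} {b} with a ≟ b
... | yes a≡b = mk⇔ (λ _ → a≡b) (λ _ → tt)
... | no  a≢b = mk⇔ (λ ()) a≢b

T-does≟-refl : ∀ {k} (a : Fin k) → T (does (a ≟ a))
T-does≟-refl a = Equivalence.from (T-does≟⇔ {a = a}) refl

pick-true : ∀ {b} (k : T b → Bool) (t : T b) → pick b k ≡ k t
pick-true {true} k _ = refl

pick-false : ∀ {b} (k : T b → Bool) → ¬ T b → pick b k ≡ false
pick-false {false} _ _  = refl
pick-false {true}  _ ¬t = ⊥-elim (¬t tt)

T-pick : ∀ {b} (k : T b → Bool) → T (pick b k) → T b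
T-pick {true} _ _ = tt

_⊆_ : ∀ {n} → Deco n → Deco n → Set
D ⊆ E = ∀ v w → T (D v w) → T (E v w)

module _ {n} {D E : Deco n} where
  ≐⇒⊆ : D ≐ E → D ⊆ E
  ≐⇒⊆ D≐E v w = subst T (D≐E v w)

  ≐-sym : D ≐ E → E ≐ D
  ≐-sym D≐E v w = sym (D≐E v w)

  ≐-trans : ∀ {F} → D ≐ E → E ≐ F → D ≐ F
  ≐-trans D≐E E≐F v w = trans (D≐E v w) (E≐F v w)

  ⊆-antisym : D ⊆ E → E ⊆ D → D ≐ E
  ⊆-antisym D⊆E E⊆D v w = T-injective (D⊆E v w) (E⊆D v w)

module _ {k} {K : Graph k} {D E : Deco k} where
  ⊆-IsState : D ⊆ E → IsState K E → IsState K D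
  ⊆-IsState D⊆E ((arrows , oneWay) , noSinkSource) =
    ( (λ v w d → arrows v w (D⊆E v w d))
    , (λ v w d d′ → oneWay v w (D⊆E v w d) (D⊆E w v d′)) )
    , λ v deg → (λ sink → proj₁ (noSinkSource v deg) (λ w a → D⊆E w v (sink w a)))
              , (λ source → proj₂ (noSinkSource v deg) (λ w a → D⊆E v w (source w a)))

≐-IsState : ∀ {k} {K : Graph k} {D E : Deco k} → D ≐ E → IsState K D → IsState K E
≐-IsState {K = K} D≐E = ⊆-IsState {K = K} (≐⇒⊆ (≐-sym D≐E))

module _ {k} (K : Graph k) (D : Deco k) {v w : Fin k} where
  unmarked⇔ : T (unmarked K D v w) ⇔ (T (adj K v w) × ¬ (T (D v w) ⊎ T (D w v)))
  unmarked⇔ = mk⇔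
    (λ u → let (a , n) = Equivalence.to (T-∧ {adj K v w}) u in
           a , λ d → Equivalence.to T-not⇔¬T n (Equivalence.from (T-∨ {D v w}) d))
    (λ (a , n) → Equivalence.from (T-∧ {adj K v w})
           (a , Equivalence.from T-not⇔¬T (λ d → n (Equivalence.to (T-∨ {D v w}) d))))

  unmarked⇒adj : T (unmarked K D v w) → T (adj K v w)
  unmarked⇒adj u = proj₁ (Equivalence.to unmarked⇔ u)

  unmarked⇒¬arrow : T (unmarked K D v w) → ¬ T (D v w)
  unmarked⇒¬arrow u d = proj₂ (Equivalence.to unmarked⇔ u) (inj₁ d)

  unmarked⇒¬reverse : T (unmarked K D v w) → ¬ T (D w v)
  unmarked⇒¬reverse u d = proj₂ (Equivalence.to unmarked⇔ u) (inj₂ d)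

  unmarked-intro : T (adj K v w) → ¬ T (D v w) → ¬ T (D w v) → T (unmarked K D v w)
  unmarked-intro a ¬d ¬d′ = Equivalence.from unmarked⇔ (a , λ { (inj₁ d) → ¬d d ; (inj₂ d′) → ¬d′ d′ })

  unmarked-flip : T (unmarked K D v w) → T (unmarked K D w v)
  unmarked-flip = subst T (unmarked-sym K D v w)

  unmarked⇒inU : T (unmarked K D v w) → T (inU K D v)
  unmarked⇒inU = anyFin-intro (unmarked K D v) w

unmarked-antitone : ∀ {k} (K : Graph k) {D E : Deco k} {v w} →
                    D ⊆ E → T (unmarked K E v w) → T (unmarked K D v w)
unmarked-antitone K {D} {E} D⊆E u =
  unmarked-intro K D (unmarked⇒adj K E u)
    (λ d → unmarked⇒¬arrow K E u (D⊆E _ _ d))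
    (λ d → unmarked⇒¬reverse K E u (D⊆E _ _ d))

Extension : ∀ {k} → Graph k → Deco k → Deco k → Set
Extension K X Z = X ⊆ Z × (∀ v w → T (Z v w) → T (X v w) ⊎ T (unmarked K X v w))

-- Descendents are the states extending X

module _ {n} (D : Deco n) (v w : Fin n) where
  add-here : T (add D v w v w)
  add-here = Equivalence.from (T-∨ {D v w})
    (inj₂ (Equivalence.from (T-∧ {does (v ≟ v)}) (T-does≟-refl v , T-does≟-refl w)))

  ⊆-add : D ⊆ add D v w
  ⊆-add a b d = Equivalence.from (T-∨ {D a b}) (inj₁ d)

  add-elim : ∀ {a b} → T (add D v w a b) → T (D a b) ⊎ (a ≡ v × b ≡ w)
  add-elim {a} {b} t with Equivalence.to (T-∨ {D a b}) t
  ... | inj₁ d = inj₁ d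
  ... | inj₂ e = let (a≟v , b≟w) = Equivalence.to (T-∧ {does (a ≟ v)}) e in
                 inj₂ (Equivalence.to T-does≟⇔ a≟v , Equivalence.to T-does≟⇔ b≟w)

  add-⊆ : ∀ {E} → D ⊆ E → T (E v w) → add D v w ⊆ E
  add-⊆ D⊆E e a b t with add-elim t
  ... | inj₁ d           = D⊆E a b d
  ... | inj₂ (refl , refl) = e

module _ {k} {K : Graph k} {X : Deco k} where
  Desc⇒Extension : ∀ {Z} → Desc K X Z → Extension K X Z
  Desc⇒Extension d-refl = (λ _ _ x → x) , (λ _ _ x → inj₁ x)
  Desc⇒Extension (d-step {Z} v w desc u _) with Desc⇒Extension desc
  ... | X⊆Z , inside = (λ a b x → ⊆-add Z v w a b (X⊆Z a b x)) , inside′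
    where
    inside′ : ∀ a b → T (add Z v w a b) → T (X a b) ⊎ T (unmarked K X a b)
    inside′ a b t with add-elim Z v w t
    ... | inj₁ z             = inside a b z
    ... | inj₂ (refl , refl) = inj₂ (unmarked-antitone K X⊆Z u)

  Desc⇒IsState : ∀ {Z} → IsState K X → Desc K X Z → IsState K Z
  Desc⇒IsState stateX d-refl              = stateX
  Desc⇒IsState _      (d-step _ _ _ _ st) = st

  module _ {E : Deco k} (stateE : IsState K E) where
    private
      Covered : Deco k → List (Fin k × Fin k) → Set
      Covered D l = ∀ a b → T (E a b) → T (D a b) ⊎ (a , b) ∈ l

      covered-tail : ∀ {D D′ v w l} → (T (E v w) → T (D′ v w)) → D ⊆ D′ →
                     Covered D ((v , w) ∷ l) → Covered D′ l
      covered-tail head D⊆D′ covered a b e with covered a b e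
      ... | inj₁ d             = inj₁ (D⊆D′ a b d)
      ... | inj₂ (here refl)   = inj₁ (head e)
      ... | inj₂ (there a,b∈l) = inj₂ a,b∈l

      -- adding a missing arrow of E gives a follower, as subsets of the state E are states
      grow : ∀ l {D} → Desc K X D → D ⊆ E → Covered D l →
             Σ (Deco k) λ Z → Desc K X Z × E ≐ Z
      grow [] {D} desc D⊆E covered =
        D , desc , ⊆-antisym (λ a b e → done (covered a b e)) D⊆E
        where
        done : ∀ {a b} → T (D a b) ⊎ (a , b) ∈ [] → T (D a b)
        done (inj₁ d) = d
      grow ((v , w) ∷ l) {D} desc D⊆E covered with T? (E v w) | T? (D v w)
      ... | yes e | no ¬d =
        grow l (d-step v w desc unmarkedInD (⊆-IsState {K = K} add⊆E stateE)) add⊆E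
          (covered-tail (λ _ → add-here D v w) (⊆-add D v w) covered)
        where
        add⊆E = add-⊆ D v w D⊆E e
        unmarkedInD = unmarked-intro K D (proj₁ (proj₁ stateE) v w e) ¬d
                        (λ d′ → proj₂ (proj₁ stateE) v w e (D⊆E w v d′))
      ... | yes _ | yes d = grow l desc D⊆E (covered-tail (λ _ → d) (λ _ _ x → x) covered)
      ... | no ¬e | _     = grow l desc D⊆E (covered-tail (λ e → ⊥-elim (¬e e)) (λ _ _ x → x) covered)

    IsState⇒Desc : X ⊆ E → Σ (Deco k) λ Z → Desc K X Z × E ≐ Z
    IsState⇒Desc X⊆E =
      grow (cartesianProduct (allFin k) (allFin k)) d-refl X⊆E
        (λ a b _ → inj₂ (∈-cartesianProduct⁺ (∈-allFin a) (∈-allFin b)))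

-- Flowers

module _ {k} (K : Graph k) (X : Deco k) (x : Fin k) where
  flowerT-elim : ∀ {a b} → T (flowerT K X x a b) → T (X a b) ⊎ (a ≡ x × T (unmarked K X x b))
  flowerT-elim {a} {b} t with Equivalence.to (T-∨ {X a b}) t
  ... | inj₁ t′ = inj₁ t′
  ... | inj₂ p  = let (a≟x , u) = Equivalence.to (T-∧ {does (a ≟ x)}) p in
                  inj₂ (Equivalence.to T-does≟⇔ a≟x , u)

  flowerH-elim : ∀ {a b} → T (flowerH K X x a b) → T (X a b) ⊎ (b ≡ x × T (unmarked K X x a))
  flowerH-elim {a} {b} t with Equivalence.to (T-∨ {X a b}) t
  ... | inj₁ t′ = inj₁ t′
  ... | inj₂ p  = let (b≟x , u) = Equivalence.to (T-∧ {does (b ≟ x)}) p in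
                  inj₂ (Equivalence.to T-does≟⇔ b≟x , u)

  ⊆-flowerT : X ⊆ flowerT K X x
  ⊆-flowerT a b t = Equivalence.from (T-∨ {X a b}) (inj₁ t)

  ⊆-flowerH : X ⊆ flowerH K X x
  ⊆-flowerH a b t = Equivalence.from (T-∨ {X a b}) (inj₁ t)

  flowerT-petal : ∀ {w} → T (unmarked K X x w) → T (flowerT K X x x w)
  flowerT-petal {w} u = Equivalence.from (T-∨ {X x w})
    (inj₂ (Equivalence.from (T-∧ {does (x ≟ x)}) (T-does≟-refl x , u)))

  flowerH-petal : ∀ {w} → T (unmarked K X x w) → T (flowerH K X x w x)
  flowerH-petal {w} u = Equivalence.from (T-∨ {X w x})
    (inj₂ (Equivalence.from (T-∧ {does (x ≟ x)}) (T-does≟-refl x , u)))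

  flowerT-extension : Extension K X (flowerT K X x)
  flowerT-extension = ⊆-flowerT , inside
    where
    inside : ∀ a b → T (flowerT K X x a b) → T (X a b) ⊎ T (unmarked K X a b)
    inside a b t with flowerT-elim t
    ... | inj₁ t′         = inj₁ t′
    ... | inj₂ (refl , u) = inj₂ u

  flowerH-extension : Extension K X (flowerH K X x)
  flowerH-extension = ⊆-flowerH , inside
    where
    inside : ∀ a b → T (flowerH K X x a b) → T (X a b) ⊎ T (unmarked K X a b)
    inside a b t with flowerH-elim t
    ... | inj₁ t′         = inj₁ t′
    ... | inj₂ (refl , u) = inj₂ (unmarked-flip K X u)

  flowerT-outside : ¬ T (inU K X x) → flowerT K X x ≐ X
  flowerT-outside ¬inU a b
    rewrite ¬T⇒≡false (λ u → ¬inU (unmarked⇒inU K X {w = b} u))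
          | ∧-zeroʳ (does (a ≟ x)) = ∨-identityʳ (X a b)

  flowerH-outside : ¬ T (inU K X x) → flowerH K X x ≐ X
  flowerH-outside ¬inU a b
    rewrite ¬T⇒≡false (λ u → ¬inU (unmarked⇒inU K X {w = a} u))
          | ∧-zeroʳ (does (b ≟ x)) = ∨-identityʳ (X a b)

  flowerT-unmarked : ∀ {a b} → T (unmarked K X a b) → flowerT K X x a b ≡ does (a ≟ x)
  flowerT-unmarked {a} {b} u rewrite ¬T⇒≡false (unmarked⇒¬arrow K X u) with a ≟ x
  ... | yes refl = Equivalence.to T-≡ u
  ... | no _     = refl

  flowerH-unmarked : ∀ {a b} → T (unmarked K X a b) → flowerH K X x a b ≡ does (b ≟ x)
  flowerH-unmarked {a} {b} u rewrite ¬T⇒≡false (unmarked⇒¬arrow K X u) with b ≟ x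
  ... | yes refl = Equivalence.to T-≡ (unmarked-flip K X u)
  ... | no _     = refl

  flowerT-marked : ∀ {a b} → ¬ T (unmarked K X a b) → flowerT K X x a b ≡ X a b
  flowerT-marked {a} {b} ¬u with a ≟ x
  ... | yes refl = trans (cong (X a b ∨_) (¬T⇒≡false ¬u)) (∨-identityʳ (X a b))
  ... | no _     = ∨-identityʳ (X a b)

  flowerH-marked : ∀ {a b} → ¬ T (unmarked K X a b) → flowerH K X x a b ≡ X a b
  flowerH-marked {a} {b} ¬u with b ≟ x
  ... | yes refl = trans (cong (X a b ∨_) (¬T⇒≡false (λ u → ¬u (unmarked-flip K X u))))
                         (∨-identityʳ (X a b))
  ... | no _     = ∨-identityʳ (X a b)

  module _ {Z : Deco k} (extension : Extension K X Z) where
    private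
      X⊆Z = proj₁ extension

      marked⇒arrow : ∀ {a b} → ¬ T (unmarked K X a b) → T (Z a b) → T (X a b)
      marked⇒arrow ¬u z with proj₂ extension _ _ z
      ... | inj₁ t = t
      ... | inj₂ u = ⊥-elim (¬u u)

    source⇒flowerT⊆ : Source K Z x → flowerT K X x ⊆ Z
    source⇒flowerT⊆ source a b t with flowerT-elim t
    ... | inj₁ t′         = X⊆Z a b t′
    ... | inj₂ (refl , u) = source b (unmarked⇒adj K X u)

    sink⇒flowerH⊆ : Sink K Z x → flowerH K X x ⊆ Z
    sink⇒flowerH⊆ sink a b t with flowerH-elim t
    ... | inj₁ t′         = X⊆Z a b t′
    ... | inj₂ (refl , u) = sink a (unmarked⇒adj K X u)

    source⇒flowerT-source : Source K Z x → Source K (flowerT K X x) x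
    source⇒flowerT-source source w a with T? (unmarked K X x w)
    ... | yes u = flowerT-petal u
    ... | no ¬u = ⊆-flowerT x w (marked⇒arrow ¬u (source w a))

    sink⇒flowerH-sink : Sink K Z x → Sink K (flowerH K X x) x
    sink⇒flowerH-sink sink w a with T? (unmarked K X x w)
    ... | yes u = flowerH-petal u
    ... | no ¬u = ⊆-flowerH w x (marked⇒arrow (λ u → ¬u (unmarked-flip K X u)) (sink w a))

-- The extension a⁺ of a bijection of arrows

module _ {n m} (G : Graph n) (H : Graph m) (X : Deco n) (Y : Deco m) where
  CommutesWithFlip : AU G X ↔ AU H Y → Set
  CommutesWithFlip a = ∀ α → Inverse.to a (flipA G X α) ≡ flipA H Y (Inverse.to a α)

  ReflectsStates : AU G X ↔ AU H Y → Set
  ReflectsStates a = ∀ Z → Extension G X Z → IsState H (aplus G H X Y a Z) → IsState G Z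

  PreservesStates : AU G X ↔ AU H Y → Set
  PreservesStates a = ∀ Z → Extension G X Z → IsState G Z ⇔ IsState H (aplus G H X Y a Z)

  ReflectsFlowerStates : AU G X ↔ AU H Y → Set
  ReflectsFlowerStates a = ∀ x → T (inU G X x) →
    (IsState H (aplus G H X Y a (flowerT G X x)) → IsState G (flowerT G X x)) ×
    (IsState H (aplus G H X Y a (flowerH G X x)) → IsState G (flowerH G X x))

module _ {n m} (G : Graph n) (H : Graph m) (X : Deco n) (Y : Deco m) where
  commutesWithFlip-sym : ∀ a → CommutesWithFlip G H X Y a → CommutesWithFlip H G Y X (↔-sym a)
  commutesWithFlip-sym a commutes β = begin
    from (flipA H Y β)
      ≡⟨ cong (λ β′ → from (flipA H Y β′)) (sym (Inverse.strictlyInverseˡ a β)) ⟩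
    from (flipA H Y (to (from β)))
      ≡⟨ cong from (sym (commutes (from β))) ⟩
    from (to (flipA G X (from β)))
      ≡⟨ Inverse.strictlyInverseʳ a _ ⟩
    flipA G X (from β) ∎
    where
    open ≡-Reasoning
    to = Inverse.to a
    from = Inverse.from a

  module AplusProperties (a : AU G X ↔ AU H Y) where
    private
      to = Inverse.to a
      from = Inverse.from a
      a⁺ = aplus G H X Y a

    aplus-unmarked : ∀ Z (β : AU H Y) → a⁺ Z (src β) (tgt β) ≡ Z (src (from β)) (tgt (from β))
    aplus-unmarked Z β =
      trans (cong₂ _∨_ (¬T⇒≡false (unmarked⇒¬arrow H Y (proj₂ β))) (pick-true _ (proj₂ β)))
        (trans (cong (λ b → Z (src (from β)) (tgt (from β)) ∧ not b)
                     (¬T⇒≡false (unmarked⇒¬arrow G X (proj₂ (from β)))))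
               (∧-identityʳ _))

    aplus-marked : ∀ Z {v w} → ¬ T (unmarked H Y v w) → a⁺ Z v w ≡ Y v w
    aplus-marked Z {v} {w} ¬u =
      trans (cong (Y v w ∨_) (pick-false _ ¬u)) (∨-identityʳ (Y v w))

    aplus-image : ∀ Z (α : AU G X) → T (Z (src α) (tgt α)) → T (a⁺ Z (src (to α)) (tgt (to α)))
    aplus-image Z α z =
      subst T (sym (aplus-unmarked Z (to α)))
        (subst (λ α′ → T (Z (src α′) (tgt α′))) (sym (Inverse.strictlyInverseʳ a α)) z)

    aplus-mono : ∀ {Z₁ Z₂} → Z₁ ⊆ Z₂ → a⁺ Z₁ ⊆ a⁺ Z₂
    aplus-mono {Z₁} {Z₂} Z₁⊆Z₂ v w t with T? (unmarked H Y v w)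
    ... | yes u = subst T (sym (aplus-unmarked Z₂ ((v , w) , u)))
                    (Z₁⊆Z₂ _ _ (subst T (aplus-unmarked Z₁ ((v , w) , u)) t))
    ... | no ¬u = subst T (sym (aplus-marked Z₂ ¬u)) (subst T (aplus-marked Z₁ ¬u) t)

    aplus-cong : ∀ {Z₁ Z₂} → Z₁ ≐ Z₂ → a⁺ Z₁ ≐ a⁺ Z₂
    aplus-cong Z₁≐Z₂ = ⊆-antisym (aplus-mono (≐⇒⊆ Z₁≐Z₂)) (aplus-mono (≐⇒⊆ (≐-sym Z₁≐Z₂)))

    aplus-extension : ∀ Z → Extension H Y (a⁺ Z)
    aplus-extension Z = (λ v w y → Equivalence.from (T-∨ {Y v w}) (inj₁ y)) , inside
      where
      inside : ∀ v w → T (a⁺ Z v w) → T (Y v w) ⊎ T (unmarked H Y v w)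
      inside v w t with Equivalence.to (T-∨ {Y v w}) t
      ... | inj₁ y = inj₁ y
      ... | inj₂ p = inj₂ (T-pick _ p)

    aplus-reflects-decoration : CommutesWithFlip G H X Y a → IsDecoration G X → ∀ {Z} →
      Extension G X Z → IsDecoration H (a⁺ Z) → IsDecoration G Z
    aplus-reflects-decoration commutes (arrowsX , oneWayX) {Z} (_ , inside) (_ , oneWayA) =
      arrows , oneWay
      where
      arrows : ∀ v w → T (Z v w) → T (adj G v w)
      arrows v w z with inside v w z
      ... | inj₁ x = arrowsX v w x
      ... | inj₂ u = unmarked⇒adj G X u
      oneWay : ∀ v w → T (Z v w) → T (Z w v) → ⊥
      oneWay v w z z′ with inside v w z | inside w v z′
      ... | inj₁ x | inj₁ x′ = oneWayX v w x x′
      ... | inj₁ x | inj₂ u′ = unmarked⇒¬reverse G X u′ x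
      ... | inj₂ u | inj₁ x′ = unmarked⇒¬reverse G X u x′
      ... | inj₂ u | inj₂ _  =
        oneWayA _ _ (aplus-image Z α z)
          (subst (λ β → T (a⁺ Z (src β) (tgt β))) (commutes α) (aplus-image Z (flipA G X α) z′))
        where
        α : AU G X
        α = (v , w) , u

    reflectsFlowerStates⇒reflectsStates : IsState G X → CommutesWithFlip G H X Y a →
      ReflectsFlowerStates G H X Y a → ReflectsStates G H X Y a
    reflectsFlowerStates⇒reflectsStates stateX commutes flowers Z extension stateAZ =
      aplus-reflects-decoration commutes (proj₁ stateX) extension (proj₁ stateAZ) ,
      λ x deg → noSink x deg , noSource x deg
      where
      noSink : ∀ x → 2 ≤ deg G x → Sink G Z x → ⊥
      noSink x deg sink =
        proj₁ (proj₂ flowerState x deg) (sink⇒flowerH-sink G X x extension sink)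
        where
        flowerState : IsState G (flowerH G X x)
        flowerState with T? (inU G X x)
        ... | yes inU = proj₂ (flowers x inU)
                          (⊆-IsState {K = H} (aplus-mono (sink⇒flowerH⊆ G X x extension sink)) stateAZ)
        ... | no ¬inU = ≐-IsState {K = G} (≐-sym (flowerH-outside G X x ¬inU)) stateX
      noSource : ∀ x → 2 ≤ deg G x → Source G Z x → ⊥
      noSource x deg source =
        proj₂ (proj₂ flowerState x deg) (source⇒flowerT-source G X x extension source)
        where
        flowerState : IsState G (flowerT G X x)
        flowerState with T? (inU G X x)
        ... | yes inU = proj₁ (flowers x inU)
                          (⊆-IsState {K = H} (aplus-mono (source⇒flowerT⊆ G X x extension source)) stateAZ)
        ... | no ¬inU = ≐-IsState {K = G} (≐-sym (flowerT-outside G X x ¬inU)) stateX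

aplus-cancel : ∀ {n m} (G : Graph n) (H : Graph m) X Y
               (a : AU G X ↔ AU H Y) (b : AU H Y ↔ AU G X) →
               (∀ β → Inverse.from b (Inverse.from a β) ≡ β) →
               ∀ W → Extension H Y W → aplus G H X Y a (aplus H G Y X b W) ≐ W
aplus-cancel G H X Y a b cancel W (Y⊆W , inside) v w with T? (unmarked H Y v w)
... | yes u =
  trans (AplusProperties.aplus-unmarked G H X Y a (aplus H G Y X b W) β)
    (trans (AplusProperties.aplus-unmarked H G Y X b W (Inverse.from a β))
           (cong (λ β′ → W (src β′) (tgt β′)) (cancel β)))
  where
  β : AU H Y
  β = (v , w) , u
... | no ¬u =
  trans (AplusProperties.aplus-marked G H X Y a (aplus H G Y X b W) ¬u) (T-injective (Y⊆W v w) marked)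
  where
  marked : T (W v w) → T (Y v w)
  marked t with inside v w t
  ... | inj₁ y = y
  ... | inj₂ u = ⊥-elim (¬u u)

-- State isomorphisms of an arbitrary bijection

module Transfer {n m} (G : Graph n) (H : Graph m) (X : Deco n) (Y : Deco m)
                (a : AU G X ↔ AU H Y) where
  private
    a⁻¹ = ↔-sym a
    a⁺ = aplus G H X Y a
    a⁻¹⁺ = aplus H G Y X a⁻¹
    module A = AplusProperties G H X Y a
    module A⁻¹ = AplusProperties H G Y X a⁻¹

  aplus-cancelʳ : ∀ W → Extension H Y W → a⁺ (a⁻¹⁺ W) ≐ W
  aplus-cancelʳ = aplus-cancel G H X Y a a⁻¹ (Inverse.strictlyInverseˡ a)

  aplus-cancelˡ : ∀ Z → Extension G X Z → a⁻¹⁺ (a⁺ Z) ≐ Z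
  aplus-cancelˡ = aplus-cancel H G Y X a⁻¹ a (Inverse.strictlyInverseʳ a)

  aplus-injective : ∀ {Z₁ Z₂} → Extension G X Z₁ → Extension G X Z₂ → a⁺ Z₁ ≐ a⁺ Z₂ → Z₁ ≐ Z₂
  aplus-injective {Z₁} {Z₂} ext₁ ext₂ a⁺Z₁≐a⁺Z₂ =
    ≐-trans (≐-sym (aplus-cancelˡ Z₁ ext₁)) (≐-trans (A⁻¹.aplus-cong a⁺Z₁≐a⁺Z₂) (aplus-cancelˡ Z₂ ext₂))

  image-reflectsState : ∀ {F F′} → Extension G X F → a⁺ F ≐ F′ →
    (IsState G F → IsState H (a⁺ F)) → IsState G (a⁻¹⁺ F′) → IsState H F′
  image-reflectsState {F} extF a⁺F≐F′ preserve stateF′ =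
    ≐-IsState {K = H} a⁺F≐F′ (preserve (≐-IsState {K = G}
      (≐-trans (A⁻¹.aplus-cong (≐-sym a⁺F≐F′)) (aplus-cancelˡ F extF)) stateF′))

  reflections⇒preservesStates : ReflectsStates G H X Y a → ReflectsStates H G Y X a⁻¹ →
                                PreservesStates G H X Y a
  reflections⇒preservesStates reflects reflects⁻¹ Z extZ = mk⇔
    (λ stateZ → reflects⁻¹ (a⁺ Z) (A.aplus-extension Z)
                  (≐-IsState {K = G} (≐-sym (aplus-cancelˡ Z extZ)) stateZ))
    (reflects Z extZ)

  preservesStates⇒localIso : PreservesStates G H X Y a → ∀ x → LocalIso G H X Y a x
  preservesStates⇒localIso preserves (x , _) =
    preserves _ (flowerT-extension G X x) , preserves _ (flowerH-extension G X x)

  module _ (stateX : IsState G X) (stateY : IsState H Y) where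
    stateIso⇒preservesStates : StateIso G H X Y a → PreservesStates G H X Y a
    stateIso⇒preservesStates (_ , image , _ , preimage) Z extZ = mk⇔ forward backward
      where
      forward : IsState G Z → IsState H (a⁺ Z)
      forward stateZ =
        let Z′ , descZ′ , Z≐Z′ = IsState⇒Desc stateZ (proj₁ extZ)
            W , descW , a⁺Z′≐W = image Z′ descZ′
        in ≐-IsState {K = H} (≐-sym (≐-trans (A.aplus-cong Z≐Z′) a⁺Z′≐W)) (Desc⇒IsState stateY descW)
      backward : IsState H (a⁺ Z) → IsState G Z
      backward stateA⁺Z =
        let W , descW , a⁺Z≐W = IsState⇒Desc stateA⁺Z (proj₁ (A.aplus-extension Z))
            Z′ , descZ′ , a⁺Z′≐W = preimage W descW
        in ≐-IsState {K = G}
             (aplus-injective (Desc⇒Extension descZ′) extZ (≐-trans a⁺Z′≐W (≐-sym a⁺Z≐W)))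
             (Desc⇒IsState stateX descZ′)

    preservesStates⇒stateIso : CommutesWithFlip G H X Y a → PreservesStates G H X Y a →
                               StateIso G H X Y a
    preservesStates⇒stateIso commutes preserves = commutes , image , injective , preimage
      where
      image : ∀ Z → Desc G X Z → Σ (Deco m) λ W → Desc H Y W × a⁺ Z ≐ W
      image Z descZ =
        IsState⇒Desc (Equivalence.to (preserves Z (Desc⇒Extension descZ)) (Desc⇒IsState stateX descZ))
          (proj₁ (A.aplus-extension Z))
      injective : ∀ Z₁ Z₂ → Desc G X Z₁ → Desc G X Z₂ → a⁺ Z₁ ≐ a⁺ Z₂ → Z₁ ≐ Z₂
      injective _ _ desc₁ desc₂ = aplus-injective (Desc⇒Extension desc₁) (Desc⇒Extension desc₂)
      preimage : ∀ W → Desc H Y W → Σ (Deco n) λ Z → Desc G X Z × a⁺ Z ≐ W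
      preimage W descW =
        let Z′ , descZ′ , Z≐Z′ = IsState⇒Desc stateZ (proj₁ extZ)
        in Z′ , descZ′ , ≐-trans (A.aplus-cong (≐-sym Z≐Z′)) cancel
        where
        extZ = A⁻¹.aplus-extension W
        cancel = aplus-cancelʳ W (Desc⇒Extension descW)
        stateZ = Equivalence.from (preserves (a⁻¹⁺ W) extZ)
                   (≐-IsState {K = H} (≐-sym cancel) (Desc⇒IsState stateY descW))

-- The bijection induced by a graph isomorphism

module _ {k} (K : Graph k) (D : Deco k) where
  VU-≡ : {u u′ : VU K D} → proj₁ u ≡ proj₁ u′ → u ≡ u′
  VU-≡ {v , p} {.v , q} refl = cong (v ,_) (T-irrelevant p q)

  AU-≡ : {α β : AU K D} → proj₁ α ≡ proj₁ β → α ≡ β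
  AU-≡ {e , p} {.e , q} refl = cong (e ,_) (T-irrelevant p q)

module InducedArrowBij {n m} {G : Graph n} {H : Graph m} {X : Deco n} {Y : Deco m}
                       (f : GraphIsoU G H X Y) where
  private
    a = inducedArrowBij f
    bij = GraphIsoU.bij f
    fv = Inverse.to bij
    gv = Inverse.from bij
    from = Inverse.from a
    a⁺ = aplus G H X Y a
    module A = AplusProperties G H X Y a
    open Transfer G H X Y a

  fv-irrelevant : ∀ {v} (p q : T (inU G X v)) → proj₁ (fv (v , p)) ≡ proj₁ (fv (v , q))
  fv-irrelevant p q = cong (λ r → proj₁ (fv (_ , r))) (T-irrelevant p q)

  gv-injective : ∀ {u u′ : VU H Y} → proj₁ (gv u) ≡ proj₁ (gv u′) ⇔ proj₁ u ≡ proj₁ u′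
  gv-injective {u} {u′} = mk⇔
    (λ e → cong proj₁ (trans (sym (Inverse.strictlyInverseˡ bij u))
                      (trans (cong fv (VU-≡ G X e)) (Inverse.strictlyInverseˡ bij u′))))
    (λ e → cong (λ u″ → proj₁ (gv u″)) (VU-≡ H Y e))

  commutesWithFlip : CommutesWithFlip G H X Y a
  commutesWithFlip _ = AU-≡ H Y (cong₂ _,_ (fv-irrelevant _ _) (fv-irrelevant _ _))

  aplus-flowerT : ∀ (y : VU H Y) → a⁺ (flowerT G X (proj₁ (gv y))) ≐ flowerT H Y (proj₁ y)
  aplus-flowerT y v w with T? (unmarked H Y v w)
  ... | yes u = begin
    a⁺ F v w
      ≡⟨ A.aplus-unmarked F β ⟩
    F (src (from β)) (tgt (from β))
      ≡⟨ flowerT-unmarked G X _ (proj₂ (from β)) ⟩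
    does (src (from β) ≟ proj₁ (gv y))
      ≡⟨ does-⇔ (gv-injective {v , unmarked⇒inU H Y u} {y}) (_ ≟ _) (_ ≟ _) ⟩
    does (v ≟ proj₁ y)
      ≡⟨ sym (flowerT-unmarked H Y _ u) ⟩
    flowerT H Y (proj₁ y) v w ∎
    where
    open ≡-Reasoning
    F = flowerT G X (proj₁ (gv y))
    β : AU H Y
    β = (v , w) , u
  ... | no ¬u =
    trans (A.aplus-marked (flowerT G X (proj₁ (gv y))) ¬u) (sym (flowerT-marked H Y _ ¬u))

  aplus-flowerH : ∀ (y : VU H Y) → a⁺ (flowerH G X (proj₁ (gv y))) ≐ flowerH H Y (proj₁ y)
  aplus-flowerH y v w with T? (unmarked H Y v w)
  ... | yes u = begin
    a⁺ F v w
      ≡⟨ A.aplus-unmarked F β ⟩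
    F (src (from β)) (tgt (from β))
      ≡⟨ flowerH-unmarked G X _ (proj₂ (from β)) ⟩
    does (tgt (from β) ≟ proj₁ (gv y))
      ≡⟨ does-⇔ (gv-injective {w , unmarked⇒inU H Y (unmarked-flip H Y u)} {y}) (_ ≟ _) (_ ≟ _) ⟩
    does (w ≟ proj₁ y)
      ≡⟨ sym (flowerH-unmarked H Y _ u) ⟩
    flowerH H Y (proj₁ y) v w ∎
    where
    open ≡-Reasoning
    F = flowerH G X (proj₁ (gv y))
    β : AU H Y
    β = (v , w) , u
  ... | no ¬u =
    trans (A.aplus-marked (flowerH G X (proj₁ (gv y))) ¬u) (sym (flowerH-marked H Y _ ¬u))

  module _ (local : ∀ x → LocalIso G H X Y a x) where
    reflectsFlowerStates : ReflectsFlowerStates G H X Y a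
    reflectsFlowerStates x inU =
      Equivalence.from (proj₁ (local (x , inU))) , Equivalence.from (proj₂ (local (x , inU)))

    inverse-reflectsFlowerStates : ReflectsFlowerStates H G Y X (↔-sym a)
    inverse-reflectsFlowerStates y inU =
      image-reflectsState (flowerT-extension G X x) (aplus-flowerT (y , inU))
        (Equivalence.to (proj₁ local-x)) ,
      image-reflectsState (flowerH-extension G X x) (aplus-flowerH (y , inU))
        (Equivalence.to (proj₂ local-x))
      where
      x = proj₁ (gv (y , inU))
      local-x = local (gv (y , inU))

    localIsos⇒preservesStates : IsState G X → IsState H Y → PreservesStates G H X Y a
    localIsos⇒preservesStates stateX stateY =
      reflections⇒preservesStates
        (A.reflectsFlowerStates⇒reflectsStates stateX commutesWithFlip reflectsFlowerStates)
        (AplusProperties.reflectsFlowerStates⇒reflectsStates H G Y X (↔-sym a) stateY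
          (commutesWithFlip-sym G H X Y a commutesWithFlip) inverse-reflectsFlowerStates)

mainTheorem19 : ∀ {n m} (G : Graph n) (H : Graph m) (X : Deco n) (Y : Deco m) →
    IsState G X → IsState H Y → (f : GraphIsoU G H X Y) →
    StateIso G H X Y (inducedArrowBij f) ⇔
      (∀ (x : VU G X) → LocalIso G H X Y (inducedArrowBij f) x)
mainTheorem19 G H X Y stateX stateY f = mk⇔
  (λ iso → preservesStates⇒localIso (stateIso⇒preservesStates stateX stateY iso))
  (λ local → preservesStates⇒stateIso stateX stateY commutesWithFlip
               (localIsos⇒preservesStates local stateX stateY))
  where
  open Transfer G H X Y (inducedArrowBij f)
  open InducedArrowBij f
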